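{- For any integers $n \geq 3$ and $m \geq 1$, $\chi_\rho(FSSD_m(K_n)) = n+1$, where $K_n$ is the complete graph on $n$ vertices.
   Context: All graphs are finite and simple. For a positive integer $i$, an $i$-packing in a graph $G$ is a set of vertices in which any two distinct vertices are at distance greater than $i$. The packing chromatic number $\chi_\rho(G)$ is the smallest integer $k$ such that $V(G)$ can be partitioned into sets $V_1,\dots,V_k$ with each $V_i$ an $i$-packing. For a positive integer $m$, the finite super subdivision graph $FSSD_m(G)$ is obtained from $G$ by replacing each edge $uv$ of $G$ by a complete bipartite graph $K_{2,m}$ whose part of size $2$ is $\{u,v\}$; that is, the edge $uv$ is deleted and $m$ new vertices are added, each adjacent exactly to $u$ and $v$. -}

module Defs where

open import Data.Nat using (ℕ; zero; suc; _<_; _≤_)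
open import Data.Fin using (Fin; toℕ; _≟_)
open import Data.Bool using (Bool; T; not; false)
open import Data.Product using (Σ; _×_; _,_; proj₁; proj₂)
open import Data.Sum using (_⊎_; inj₁; inj₂)
open import Data.Empty using (⊥; ⊥-elim)
open import Relation.Nullary using (¬_; yes; no)
open import Relation.Nullary.Decidable using (⌊_⌋)
open import Relation.Binary.PropositionalEquality using (_≡_; _≢_; refl; sym)

record Graph : Set₁ where
  field
    V   : Set
    Adj : V → V → Set
open Graph public

record FinSimpleGraph : Set where
  field
    N      : ℕ
    adj    : Fin N → Fin N → Bool
    adj-sym : ∀ u v → adj u v ≡ adj v u
    irrefl : ∀ u → adj u u ≡ false
open FinSimpleGraph public

toGraph : FinSimpleGraph → Graph
toGraph G = record { V = Fin (N G) ; Adj = λ u v → T (adj G u v) }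

Kadj : (n : ℕ) → Fin n → Fin n → Bool
Kadj n u v = not ⌊ u ≟ v ⌋

Kadj-sym : ∀ n (u v : Fin n) → Kadj n u v ≡ Kadj n v u
Kadj-sym n u v with u ≟ v | v ≟ u
... | yes _ | yes _ = refl
... | no _  | no _  = refl
... | yes p | no q  = ⊥-elim (q (sym p))
... | no p  | yes q = ⊥-elim (p (sym q))

Kadj-irrefl : ∀ n (u : Fin n) → Kadj n u u ≡ false
Kadj-irrefl n u with u ≟ u
... | yes _ = refl
... | no q  = ⊥-elim (q refl)

K : ℕ → FinSimpleGraph
K n = record { N = n ; adj = Kadj n ; adj-sym = Kadj-sym n ; irrefl = Kadj-irrefl n }

-- Edges of a finite simple graph, each unordered edge {u,v} listed once as
-- an ordered pair (u , v) with toℕ u < toℕ v.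
Edge : FinSimpleGraph → Set
Edge G = Σ (Fin (N G) × Fin (N G)) λ p →
           T (adj G (proj₁ p) (proj₂ p)) × (toℕ (proj₁ p) < toℕ (proj₂ p))

-- Finite super subdivision FSSD_m(G): original vertices plus m new vertices
-- per edge uv, each new vertex adjacent exactly to u and v; the original
-- edges are deleted.
FSSD-V : ℕ → FinSimpleGraph → Set
FSSD-V m G = Fin (N G) ⊎ (Edge G × Fin m)

FSSD-Adj : (m : ℕ) (G : FinSimpleGraph) → FSSD-V m G → FSSD-V m G → Set
FSSD-Adj m G (inj₁ u) (inj₁ v) = ⊥
FSSD-Adj m G (inj₁ u) (inj₂ (((a , b) , _) , _)) = (u ≡ a) ⊎ (u ≡ b)
FSSD-Adj m G (inj₂ (((a , b) , _) , _)) (inj₁ u) = (u ≡ a) ⊎ (u ≡ b)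
FSSD-Adj m G (inj₂ _) (inj₂ _) = ⊥

FSSD : ℕ → FinSimpleGraph → Graph
FSSD m G = record { V = FSSD-V m G ; Adj = FSSD-Adj m G }

-- Walks of length at most i: WalkLe G i u v holds iff d_G(u,v) ≤ i.
data WalkLe (G : Graph) : ℕ → V G → V G → Set where
  here : ∀ {i u} → WalkLe G i u u
  step : ∀ {i u w v} → Adj G u w → WalkLe G i w v → WalkLe G (suc i) u v

IsPacking : (G : Graph) → ℕ → (V G → Set) → Set
IsPacking G i S = ∀ u v → S u → S v → u ≢ v → ¬ WalkLe G i u v

-- A packing k-colouring: V(G) partitioned into V_1,…,V_k (class of colour
-- j : Fin k is V_{j+1}), where V_{j+1} is a (j+1)-packing.
PackingColourable : Graph → ℕ → Set
PackingColourable G k =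
  Σ (V G → Fin k) λ c → ∀ (j : Fin k) → IsPacking G (suc (toℕ j)) (λ v → c v ≡ j)

PackingChromaticNumberIs : Graph → ℕ → Set
PackingChromaticNumberIs G k =
  PackingColourable G k × (∀ j → PackingColourable G j → k ≤ j)

module Submission where

-- χ_ρ(FSSD_m(K_n)) = n + 1 for n ≥ 3 and m ≥ 1.  In this comment colours are
-- 1-based; in the code colour j : Fin k names the (j+1)-packing, so "colour 1"
-- is the index fz.
--
-- Upper bound, valid for every finite simple graph H: the subdivision vertices
-- of FSSD_m(H) are pairwise non-adjacent, so they form the 1-packing, and the
-- |V(H)| original vertices receive the distinct colours 2, …, |V(H)| + 1.
--
-- Lower bound: take a packing colouring of FSSD_m(K_n) with k ≤ n colours.
-- Original vertices are pairwise at distance 2, so not all of them avoid colour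
-- 1 (they would need n distinct colours ≥ 2).  Fix an original z of colour 1.
-- The subdivision vertices on the edges at z ("spokes") are pairwise at
-- distance 2 and not coloured 1, so together with colour 1 they exhaust all k
-- colours.  Comparing distances to the spokes yields: every other original
-- has colour ≤ 2, hence of two originals one has colour 1; no subdivision
-- vertex has colour 1; and a subdivision vertex of colour ≥ 4 is incident with
-- every original of colour 1.  On a triangle 0,1,2 of K_n the three
-- subdivision vertices are therefore pairwise at distance 2 with colours in
-- {2, 3}, which is impossible.

open import Defs
open import Data.Nat using (ℕ; zero; suc; _+_; _≤_; _<_; z≤n; s≤s)
open import Data.Nat.Properties using (+-comm; ≤-trans; ≤-reflexive; _≤?_; _<?_; ≰⇒>; ≮⇒≥; ≤∧≢⇒<; 1+n≰n)
open import Data.Fin using (Fin; toℕ; fromℕ<; _≟_) renaming (zero to fz; suc to fs)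
open import Data.Fin.Properties using (toℕ-injective; toℕ-fromℕ<; toℕ<n; injective⇒≤; any?)
open import Data.Bool using (T)
open import Data.Unit using (tt)
open import Data.Product using (Σ; _×_; _,_; proj₁; proj₂; ∃)
open import Data.Sum using (_⊎_; inj₁; inj₂)
open import Data.Empty using (⊥; ⊥-elim)
open import Function.Definitions using (Injective)
open import Relation.Nullary using (¬_; yes; no)
open import Relation.Binary.PropositionalEquality using (_≡_; _≢_; refl; sym; trans; cong; subst)

walk-weaken : ∀ {G i i' u v} → WalkLe G i u v → i ≤ i' → WalkLe G i' u v
walk-weaken here          _       = here
walk-weaken (step uw wv) (s≤s le) = step uw (walk-weaken wv le)

module _ {G : Graph} where
  walk₁ : ∀ {p q} → Adj G p q → WalkLe G 1 p q
  walk₁ pq = step pq here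

  walk₂ : ∀ {p q} r → Adj G p r → Adj G r q → WalkLe G 2 p q
  walk₂ r pr rq = step {w = r} pr (walk₁ rq)

  walk₃ : ∀ {p q} r s → Adj G p r → Adj G r s → Adj G s q → WalkLe G 3 p q
  walk₃ r s pr rs sq = step {w = r} pr (walk₂ s rs sq)

  walk₄ : ∀ {p q} r s t → Adj G p r → Adj G r s → Adj G s t → Adj G t q → WalkLe G 4 p q
  walk₄ r s t pr rs st tq = step {w = r} pr (walk₃ s t rs st tq)

module PackingColouring {G : Graph} {k : ℕ} (c : V G → Fin k)
    (packing : ∀ j → IsPacking G (suc (toℕ j)) (λ v → c v ≡ j)) where

  clash : ∀ {p q d} → p ≢ q → WalkLe G d p q → d ≤ suc (toℕ (c p)) → c p ≢ c q
  clash {p} p≢q walk d≤ same = packing (c p) p _ refl (sym same) p≢q (walk-weaken walk d≤)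

nonzero-index : ∀ {k} (x : Fin (suc k)) → x ≢ fz → 1 ≤ toℕ x
nonzero-index fz     x≢0 = ⊥-elim (x≢0 refl)
nonzero-index (fs _) _   = s≤s z≤n

positive-index : ∀ {k} {x : Fin (suc k)} → 1 ≤ toℕ x → x ≢ fz
positive-index () refl

index-one-unique : ∀ {k} (x y : Fin (suc k)) → x ≢ fz → y ≢ fz → toℕ x ≤ 1 → toℕ y ≤ 1 → x ≡ y
index-one-unique fz          _           x≢0 _   _          _          = ⊥-elim (x≢0 refl)
index-one-unique _           fz          _   y≢0 _          _          = ⊥-elim (y≢0 refl)
index-one-unique (fs fz)     (fs fz)     _   _   _          _          = refl
index-one-unique (fs (fs _)) _           _   _   (s≤s ())   _
index-one-unique _           (fs (fs _)) _   _   _          (s≤s ())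

-- A map Fin n → Fin k with k ≤ n and pairwise distinct values is onto: a
-- missed value y could be prepended, giving an injection Fin (1 + n) → Fin k.
distinct-values-cover : ∀ {n k} → k ≤ n → (g : Fin n → Fin k) →
  (∀ {a b} → a ≢ b → g a ≢ g b) → ∀ y → ∃ λ a → g a ≡ y
distinct-values-cover {n} {k} k≤n g distinct y with any? (λ a → g a ≟ y)
... | yes hit  = hit
... | no  miss = ⊥-elim (1+n≰n (≤-trans (injective⇒≤ prepend-injective) k≤n))
  where
  prepend : Fin (suc n) → Fin k
  prepend fz     = y
  prepend (fs a) = g a

  g-injective : Injective _≡_ _≡_ g
  g-injective {a} {b} same with a ≟ b
  ... | yes a≡b = a≡b
  ... | no  a≢b = ⊥-elim (distinct a≢b same)

  prepend-injective : Injective _≡_ _≡_ prepend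
  prepend-injective {fz}   {fz}   _    = refl
  prepend-injective {fz}   {fs b} same = ⊥-elim (miss (b , sym same))
  prepend-injective {fs a} {fz}   same = ⊥-elim (miss (a , same))
  prepend-injective {fs a} {fs b} same = cong fs (g-injective same)

one-or-two : ∀ a → 1 ≤ a → a ≤ 2 → a ≡ 1 ⊎ a ≡ 2
one-or-two 1 _ _ = inj₁ refl
one-or-two 2 _ _ = inj₂ refl
one-or-two (suc (suc (suc _))) _ (s≤s (s≤s ()))

no-three-in-one-two : ∀ a b c → 1 ≤ a → a ≤ 2 → 1 ≤ b → b ≤ 2 → 1 ≤ c → c ≤ 2 →
  a ≢ b → a ≢ c → b ≢ c → ⊥
no-three-in-one-two a b c 1≤a a≤2 1≤b b≤2 1≤c c≤2 a≢b a≢c b≢c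
  with one-or-two a 1≤a a≤2 | one-or-two b 1≤b b≤2 | one-or-two c 1≤c c≤2
... | inj₁ refl | inj₁ refl | _         = a≢b refl
... | inj₂ refl | inj₂ refl | _         = a≢b refl
... | inj₁ refl | inj₂ refl | inj₁ refl = a≢c refl
... | inj₂ refl | inj₁ refl | inj₂ refl = a≢c refl
... | inj₁ refl | inj₂ refl | inj₂ refl = b≢c refl
... | inj₂ refl | inj₁ refl | inj₁ refl = b≢c refl

fssd-packing-colourable : ∀ m H → PackingColourable (FSSD m H) (suc (N H))
fssd-packing-colourable m H = colour , packing
  where
  colour : FSSD-V m H → Fin (suc (N H))
  colour (inj₁ v) = fs v
  colour (inj₂ _) = fz

  subdivision-independent : ∀ {e e'} → WalkLe (FSSD m H) 1 (inj₂ e) (inj₂ e') →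
    _≡_ {A = FSSD-V m H} (inj₂ e) (inj₂ e')
  subdivision-independent here                     = refl
  subdivision-independent (step {w = inj₁ _} _ ())
  subdivision-independent (step {w = inj₂ _} () _)

  packing : ∀ j → IsPacking (FSSD m H) (suc (toℕ j)) (λ v → colour v ≡ j)
  packing _ (inj₁ a) (inj₁ .a) refl refl a≢a _    = a≢a refl
  packing _ (inj₁ _) (inj₂ _)  refl ()
  packing _ (inj₂ _) (inj₁ _)  refl ()
  packing _ (inj₂ _) (inj₂ _)  refl refl e≢e' walk = e≢e' (subdivision-independent walk)

module CompleteSubdivision (n m : ℕ) where

  -- FSSD_{m+1}(K_n); m + 1 ≥ 1 guarantees a subdivision vertex on every edge.
  G : Graph
  G = FSSD (suc m) (K n)

  SamePair : (a b p q : Fin n) → Set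
  SamePair a b p q = (a ≡ p × b ≡ q) ⊎ (a ≡ q × b ≡ p)

  distinct-adjacent : ∀ {a b : Fin n} → a ≢ b → T (Kadj n a b)
  distinct-adjacent {a} {b} a≢b with a ≟ b
  ... | yes a≡b = ⊥-elim (a≢b a≡b)
  ... | no  _   = tt

  edge : (a b : Fin n) → a ≢ b → Edge (K n)
  edge a b a≢b with toℕ a <? toℕ b
  ... | yes a<b = (a , b) , distinct-adjacent a≢b , a<b
  ... | no  a≮b = (b , a) , distinct-adjacent (λ b≡a → a≢b (sym b≡a)) ,
                  ≤∧≢⇒< (≮⇒≥ a≮b) (λ b≡a → a≢b (toℕ-injective (sym b≡a)))

  edge-ends : ∀ a b a≢b → SamePair a b (proj₁ (proj₁ (edge a b a≢b))) (proj₂ (proj₁ (edge a b a≢b)))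
  edge-ends a b a≢b with toℕ a <? toℕ b
  ... | yes _ = inj₁ (refl , refl)
  ... | no  _ = inj₂ (refl , refl)

  sub : (a b : Fin n) → a ≢ b → V G
  sub a b a≢b = inj₂ (edge a b a≢b , fz)

  sub-adj₁ : ∀ a b a≢b → Adj G (inj₁ a) (sub a b a≢b)
  sub-adj₁ a b a≢b with edge-ends a b a≢b
  ... | inj₁ (a≡p , _) = inj₁ a≡p
  ... | inj₂ (a≡q , _) = inj₂ a≡q

  sub-adj₂ : ∀ a b a≢b → Adj G (inj₁ b) (sub a b a≢b)
  sub-adj₂ a b a≢b with edge-ends a b a≢b
  ... | inj₁ (_ , b≡q) = inj₂ b≡q
  ... | inj₂ (_ , b≡p) = inj₁ b≡p

  sub-ends : ∀ {a b c d a≢b c≢d} → sub a b a≢b ≡ sub c d c≢d →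
    (c ≡ a ⊎ c ≡ b) × (d ≡ a ⊎ d ≡ b)
  sub-ends {a} {b} {c} {d} {a≢b} {c≢d} same =
    compare (edge-ends a b a≢b) (edge-ends c d c≢d) (cong endpoints same)
    where
    endpoints : V G → Fin n × Fin n
    endpoints (inj₁ v)       = v , v
    endpoints (inj₂ (e , _)) = proj₁ e

    compare : ∀ {p q p' q'} → SamePair a b p q → SamePair c d p' q' → (p , q) ≡ (p' , q') →
      (c ≡ a ⊎ c ≡ b) × (d ≡ a ⊎ d ≡ b)
    compare (inj₁ (refl , refl)) (inj₁ (refl , refl)) refl = inj₁ refl , inj₂ refl
    compare (inj₁ (refl , refl)) (inj₂ (refl , refl)) refl = inj₂ refl , inj₁ refl
    compare (inj₂ (refl , refl)) (inj₁ (refl , refl)) refl = inj₂ refl , inj₁ refl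
    compare (inj₂ (refl , refl)) (inj₂ (refl , refl)) refl = inj₁ refl , inj₂ refl

  module SmallColouring {k : ℕ} (c : V G → Fin (suc k))
      (packing : ∀ j → IsPacking G (suc (toℕ j)) (λ v → c v ≡ j))
      (few-colours : suc k ≤ n) where
    open PackingColouring c packing

    adjacent-clash : ∀ {p q} → p ≢ q → Adj G p q → c p ≢ c q
    adjacent-clash p≢q pq = clash p≢q (walk₁ pq) (s≤s z≤n)

    -- Distinct originals are at distance 2, so they can only share colour 1.
    originals-clash : ∀ {a b} → a ≢ b → c (inj₁ a) ≢ fz → c (inj₁ a) ≢ c (inj₁ b)
    originals-clash {a} {b} a≢b a≢1 =
      clash (λ { refl → a≢b refl })
            (walk₂ (sub a b a≢b) (sub-adj₁ a b a≢b) (sub-adj₂ a b a≢b))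
            (s≤s (nonzero-index _ a≢1))

    -- Some original has colour 1: otherwise the originals would take n pairwise
    -- distinct colours and so cover colour 1 as well.
    some-original-coloured-1 : ∃ λ z → c (inj₁ z) ≡ fz
    some-original-coloured-1 with any? (λ z → c (inj₁ z) ≟ fz)
    ... | yes found = found
    ... | no  none  = ⊥-elim (none (distinct-values-cover few-colours (λ a → c (inj₁ a))
                        (λ a≢b → originals-clash a≢b (λ a≡1 → none (_ , a≡1))) fz))

    module Spokes (z : Fin n) (z≡1 : c (inj₁ z) ≡ fz) where

      -- A spoke is adjacent to z, so it does not have colour 1.
      spoke-colour : ∀ v z≢v → c (sub z v z≢v) ≢ fz
      spoke-colour v z≢v s≡1 = adjacent-clash (λ ()) (sub-adj₁ z v z≢v) (trans s≡1 (sym z≡1))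

      palette : Fin n → Fin (suc k)
      palette v with z ≟ v
      ... | yes _   = fz
      ... | no  z≢v = c (sub z v z≢v)

      -- Spokes are pairwise at distance 2, so the palette has no repetition.
      palette-distinct : ∀ {v w} → v ≢ w → palette v ≢ palette w
      palette-distinct {v} {w} v≢w with z ≟ v | z ≟ w
      ... | yes z≡v | yes z≡w = ⊥-elim (v≢w (trans (sym z≡v) z≡w))
      ... | yes _   | no  z≢w = λ 1≡w → spoke-colour w z≢w (sym 1≡w)
      ... | no  z≢v | yes _   = spoke-colour v z≢v
      ... | no  z≢v | no  z≢w =
        clash spokes-differ (walk₂ (inj₁ z) (sub-adj₁ z v z≢v) (sub-adj₁ z w z≢w))
              (s≤s (nonzero-index _ (spoke-colour v z≢v)))
        where
        spokes-differ : sub z v z≢v ≢ sub z w z≢w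
        spokes-differ same with proj₂ (sub-ends same)
        ... | inj₁ w≡z = z≢w (sym w≡z)
        ... | inj₂ w≡v = v≢w (sym w≡v)

      OnSpoke : V G → Set
      OnSpoke y = ∃ λ v → Σ (z ≢ v) λ z≢v → c y ≡ c (sub z v z≢v)

      -- Having at most n colours, the palette uses all of them: every colour
      -- other than 1 already appears on a spoke at z.
      spokes-cover : ∀ y → c y ≢ fz → OnSpoke y
      spokes-cover y y≢1 = on-spoke (distinct-values-cover few-colours palette palette-distinct (c y))
        where
        on-spoke : (∃ λ v → palette v ≡ c y) → OnSpoke y
        on-spoke (v , hit) with z ≟ v
        ... | yes _   = ⊥-elim (y≢1 (sym hit))
        ... | no  z≢v = v , z≢v , sym hit

      -- Another original is at distance ≤ 3 from every spoke, so its colour is ≤ 2.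
      other-original-colour : ∀ v → z ≢ v → toℕ (c (inj₁ v)) ≤ 1
      other-original-colour v z≢v with toℕ (c (inj₁ v)) ≤? 1
      ... | yes small = small
      ... | no  large = ⊥-elim (far (spokes-cover (inj₁ v) (positive-index (≤-trans (s≤s z≤n) 2≤v))))
        where
        2≤v : 2 ≤ toℕ (c (inj₁ v))
        2≤v = ≰⇒> large

        far : OnSpoke (inj₁ v) → ⊥
        far (w , z≢w , same) =
          clash (λ ()) (walk₃ (sub z v z≢v) (inj₁ z) (sub-adj₂ z v z≢v) (sub-adj₁ z v z≢v) (sub-adj₁ z w z≢w))
                (s≤s 2≤v) same

      -- A subdivision vertex not incident with z is at distance ≤ 4 from every
      -- spoke, so if its colour is ≥ 4 it must be incident with z.
      high-sub-at-z : ∀ a b a≢b → 3 ≤ toℕ (c (sub a b a≢b)) → z ≡ a ⊎ z ≡ b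
      high-sub-at-z a b a≢b 3≤ab with z ≟ a | z ≟ b
      ... | yes z≡a | _       = inj₁ z≡a
      ... | no  _   | yes z≡b = inj₂ z≡b
      ... | no  z≢a | no  z≢b = ⊥-elim (far (spokes-cover (sub a b a≢b) (positive-index (≤-trans (s≤s z≤n) 3≤ab))))
        where
        far : OnSpoke (sub a b a≢b) → ⊥
        far (w , z≢w , same) =
          clash away (walk₄ (inj₁ a) (sub z a z≢a) (inj₁ z)
                        (sub-adj₁ a b a≢b) (sub-adj₂ z a z≢a) (sub-adj₁ z a z≢a) (sub-adj₁ z w z≢w))
                (s≤s 3≤ab) same
          where
          away : sub a b a≢b ≢ sub z w z≢w
          away same with proj₁ (sub-ends same)
          ... | inj₁ z≡a = z≢a z≡a
          ... | inj₂ z≡b = z≢b z≡b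

    original-colour : ∀ a → toℕ (c (inj₁ a)) ≤ 1
    original-colour a with some-original-coloured-1
    ... | z , z≡1 with z ≟ a
    ...   | yes refl = subst (λ x → toℕ x ≤ 1) (sym z≡1) z≤n
    ...   | no  z≢a  = Spokes.other-original-colour z z≡1 a z≢a

    -- Of two distinct originals one has colour 1, since colour 2 cannot repeat
    -- at distance 2.
    one-of-two-coloured-1 : ∀ {a b} → a ≢ b → c (inj₁ a) ≡ fz ⊎ c (inj₁ b) ≡ fz
    one-of-two-coloured-1 {a} {b} a≢b with c (inj₁ a) ≟ fz | c (inj₁ b) ≟ fz
    ... | yes a≡1 | _       = inj₁ a≡1
    ... | no  _   | yes b≡1 = inj₂ b≡1
    ... | no  a≢1 | no  b≢1 = ⊥-elim (originals-clash a≢b a≢1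
          (index-one-unique _ _ a≢1 b≢1 (original-colour a) (original-colour b)))

    -- No subdivision vertex has colour 1: one of its ends has colour 1.
    sub-colour : ∀ a b a≢b → c (sub a b a≢b) ≢ fz
    sub-colour a b a≢b ab≡1 with one-of-two-coloured-1 a≢b
    ... | inj₁ a≡1 = adjacent-clash (λ ()) (sub-adj₁ a b a≢b) (trans ab≡1 (sym a≡1))
    ... | inj₂ b≡1 = adjacent-clash (λ ()) (sub-adj₂ a b a≢b) (trans ab≡1 (sym b≡1))

    high-sub-meets : ∀ a b a≢b → 3 ≤ toℕ (c (sub a b a≢b)) →
      ∀ {p q} → p ≢ q → (p ≡ a ⊎ p ≡ b) ⊎ (q ≡ a ⊎ q ≡ b)
    high-sub-meets a b a≢b 3≤ab p≢q with one-of-two-coloured-1 p≢q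
    ... | inj₁ p≡1 = inj₁ (Spokes.high-sub-at-z _ p≡1 a b a≢b 3≤ab)
    ... | inj₂ q≡1 = inj₂ (Spokes.high-sub-at-z _ q≡1 a b a≢b 3≤ab)

    sub-clash : ∀ a b a≢b u → sub a b a≢b ≢ u → WalkLe G 2 (sub a b a≢b) u →
      toℕ (c (sub a b a≢b)) ≢ toℕ (c u)
    sub-clash a b a≢b u ab≢u walk same =
      clash ab≢u walk (s≤s (nonzero-index _ (sub-colour a b a≢b))) (toℕ-injective same)

    -- On the triangle of the first three originals every subdivision vertex has
    -- colour ≤ 3: colour ≥ 4 would give 4 ≤ n, and then the third triangle
    -- vertex r and the fourth original both avoid {a, b}.
    triangle-sub-small : ∀ a b a≢b r → r ≢ a → r ≢ b →
      toℕ a ≤ 2 → toℕ b ≤ 2 → toℕ r ≤ 2 → toℕ (c (sub a b a≢b)) ≤ 2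
    triangle-sub-small a b a≢b r r≢a r≢b a≤2 b≤2 r≤2 with toℕ (c (sub a b a≢b)) ≤? 2
    ... | yes small = small
    ... | no  large = ⊥-elim (outside (high-sub-meets a b a≢b 3≤ab (λ r≡f → fresh r r≤2 (sym r≡f))))
      where
      3≤ab : 3 ≤ toℕ (c (sub a b a≢b))
      3≤ab = ≰⇒> large

      3<n : 3 < n
      3<n = ≤-trans (s≤s 3≤ab) (≤-trans (toℕ<n _) few-colours)

      fourth : Fin n
      fourth = fromℕ< 3<n

      fresh : ∀ x → toℕ x ≤ 2 → fourth ≢ x
      fresh x x≤2 refl with ≤-trans (≤-reflexive (sym (toℕ-fromℕ< 3<n))) x≤2
      ... | s≤s (s≤s ())

      outside : (r ≡ a ⊎ r ≡ b) ⊎ (fourth ≡ a ⊎ fourth ≡ b) → ⊥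
      outside (inj₁ (inj₁ r≡a)) = r≢a r≡a
      outside (inj₁ (inj₂ r≡b)) = r≢b r≡b
      outside (inj₂ (inj₁ f≡a)) = fresh a a≤2 f≡a
      outside (inj₂ (inj₂ f≡b)) = fresh b b≤2 f≡b

-- The three subdivision vertices on the triangle
-- 0, 1, 2 are pairwise at distance 2 and have colours in {2, 3}.
no-small-packing-colouring : ∀ n m k → 3 ≤ n → k ≤ n → ¬ PackingColourable (FSSD (suc m) (K n)) k
no-small-packing-colouring (suc (suc (suc _))) m zero (s≤s (s≤s (s≤s _))) _ (c , _) with c (inj₁ fz)
... | ()
no-small-packing-colouring n@(suc (suc (suc _))) m (suc k) (s≤s (s≤s (s≤s _))) few-colours (c , packing) =
  no-three-in-one-two (toℕ (c t₀₁)) (toℕ (c t₀₂)) (toℕ (c t₁₂))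
    (nonzero-index _ (sub-colour v₀ v₁ 0≢1)) (triangle-sub-small v₀ v₁ 0≢1 v₂ (λ ()) (λ ()) 0≤2 1≤2 2≤2)
    (nonzero-index _ (sub-colour v₀ v₂ 0≢2)) (triangle-sub-small v₀ v₂ 0≢2 v₁ (λ ()) (λ ()) 0≤2 2≤2 1≤2)
    (nonzero-index _ (sub-colour v₁ v₂ 1≢2)) (triangle-sub-small v₁ v₂ 1≢2 v₀ (λ ()) (λ ()) 1≤2 2≤2 0≤2)
    (sub-clash v₀ v₁ 0≢1 t₀₂ (λ same → [0,1]∌2 (proj₂ (sub-ends {a≢b = 0≢1} {c≢d = 0≢2} same)))
          (walk₂ (inj₁ v₀) (sub-adj₁ v₀ v₁ 0≢1) (sub-adj₁ v₀ v₂ 0≢2)))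
    (sub-clash v₀ v₁ 0≢1 t₁₂ (λ same → [0,1]∌2 (proj₂ (sub-ends {a≢b = 0≢1} {c≢d = 1≢2} same)))
          (walk₂ (inj₁ v₁) (sub-adj₂ v₀ v₁ 0≢1) (sub-adj₁ v₁ v₂ 1≢2)))
    (sub-clash v₀ v₂ 0≢2 t₁₂ (λ same → [0,2]∌1 (proj₁ (sub-ends {a≢b = 0≢2} {c≢d = 1≢2} same)))
          (walk₂ (inj₁ v₂) (sub-adj₂ v₀ v₂ 0≢2) (sub-adj₂ v₁ v₂ 1≢2)))
  where
  open CompleteSubdivision n m
  open SmallColouring c packing few-colours

  v₀ v₁ v₂ : Fin n
  v₀ = fz
  v₁ = fs fz
  v₂ = fs (fs fz)

  0≤2 : toℕ v₀ ≤ 2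
  0≤2 = z≤n
  1≤2 : toℕ v₁ ≤ 2
  1≤2 = s≤s z≤n
  2≤2 : toℕ v₂ ≤ 2
  2≤2 = s≤s (s≤s z≤n)

  0≢1 : v₀ ≢ v₁
  0≢1 ()
  0≢2 : v₀ ≢ v₂
  0≢2 ()
  1≢2 : v₁ ≢ v₂
  1≢2 ()

  [0,1]∌2 : ¬ (v₂ ≡ v₀ ⊎ v₂ ≡ v₁)
  [0,1]∌2 (inj₁ ())
  [0,1]∌2 (inj₂ ())

  [0,2]∌1 : ¬ (v₁ ≡ v₀ ⊎ v₁ ≡ v₂)
  [0,2]∌1 (inj₁ ())
  [0,2]∌1 (inj₂ ())

  t₀₁ t₀₂ t₁₂ : V G
  t₀₁ = sub v₀ v₁ 0≢1
  t₀₂ = sub v₀ v₂ 0≢2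
  t₁₂ = sub v₁ v₂ 1≢2

corollary1 : (n m : ℕ) → 3 ≤ n → 1 ≤ m →
    PackingChromaticNumberIs (FSSD m (K n)) (n + 1)
corollary1 n (suc m) 3≤n _ = colourable , minimal
  where
  colourable : PackingColourable (FSSD (suc m) (K n)) (n + 1)
  colourable = subst (PackingColourable (FSSD (suc m) (K n))) (+-comm 1 n)
                     (fssd-packing-colourable (suc m) (K n))

  minimal : ∀ j → PackingColourable (FSSD (suc m) (K n)) j → n + 1 ≤ j
  minimal j colouring with j ≤? n
  ... | yes j≤n = ⊥-elim (no-small-packing-colouring n m j 3≤n j≤n colouring)
  ... | no  j≰n = subst (_≤ j) (+-comm 1 n) (≰⇒> j≰n)
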